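{- Let $G\in\varepsilon_{12}$ and let $C,C'$ be two cycles of $G$ whose intersection is a path $P_t$ with $t>0$ edges. If both $C,C'$ are of type $2$, or one is of type $1$ and the other of type $2$, then $t$ is odd. If both are of type $1$, then $t$ is even.
   Context: All graphs are finite, simple and connected. An Euler graph is a connected graph all of whose nodes have even degree. A cycle of length $n$ is of type $i$ if $n\equiv i\pmod 4$. $\varepsilon_{12}$ is the class of Euler graphs in which every cycle has length $\equiv 1$ or $\equiv 2\pmod 4$ and which contain at least one cycle of each of the types $1$ and $2$. -}

module Defs where

open import Data.Nat using (ℕ; zero; suc; _+_; _∸_; _≤_; _<_; _%_)
open import Data.Nat.Divisibility using (_∣_)
open import Data.Fin using (Fin; toℕ)
open import Data.List using (List; map)
open import Data.Nat.ListAction using (sum)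
open import Data.List.Base using (allFin)
open import Data.Bool using (Bool; true; false; if_then_else_)
open import Data.Product using (Σ; ∃; _×_; _,_)
open import Data.Sum using (_⊎_)
open import Relation.Binary.PropositionalEquality using (_≡_)
open import Function.Definitions using (Injective)

record Graph (n : ℕ) : Set where
  field
    adj   : Fin n → Fin n → Bool
    sym   : ∀ u v → adj u v ≡ adj v u
    irrefl : ∀ v → adj v v ≡ false
open Graph public

module _ {n : ℕ} (G : Graph n) where

  Adj : Fin n → Fin n → Set
  Adj u v = adj G u v ≡ true

  degree : Fin n → ℕ
  degree v = sum (map (λ w → if adj G v w then 1 else 0) (allFin n))

  data Reach : Fin n → Fin n → Set where
    here : ∀ {u} → Reach u u
    step : ∀ {u w v} → Adj u w → Reach w v → Reach u v

  Connected : Set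
  Connected = ∀ u v → Reach u v

  Euler : Set
  Euler = Connected × (∀ v → 2 ∣ degree v)

CycNext : (k : ℕ) → Fin k → Fin k → Set
CycNext k i j = (toℕ j ≡ suc (toℕ i)) ⊎ ((suc (toℕ i) ≡ k) × (toℕ j ≡ 0))

record Cycle {n : ℕ} (G : Graph n) : Set where
  field
    len      : ℕ
    len≥3    : 3 ≤ len
    vert     : Fin len → Fin n
    vert-inj : Injective _≡_ _≡_ vert
    edges    : ∀ i j → CycNext len i j → Adj G (vert i) (vert j)
open Cycle public

record Path {n : ℕ} (G : Graph n) (t : ℕ) : Set where
  field
    pvert     : Fin (suc t) → Fin n
    pvert-inj : Injective _≡_ _≡_ pvert
    pedges    : ∀ i j → toℕ j ≡ suc (toℕ i) → Adj G (pvert i) (pvert j)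
open Path public

module _ {n : ℕ} {G : Graph n} where

  OnCycle : Cycle G → Fin n → Set
  OnCycle C u = ∃ λ i → vert C i ≡ u

  CycleEdge : Cycle G → Fin n → Fin n → Set
  CycleEdge C u v = Σ (Fin (len C)) λ i → Σ (Fin (len C)) λ j → CycNext (len C) i j ×
    ((vert C i ≡ u × vert C j ≡ v) ⊎ (vert C i ≡ v × vert C j ≡ u))

  OnPath : ∀ {t} → Path G t → Fin n → Set
  OnPath P u = ∃ λ i → pvert P i ≡ u

  PathEdge : ∀ {t} → Path G t → Fin n → Fin n → Set
  PathEdge {t} P u v = Σ (Fin (suc t)) λ i → Σ (Fin (suc t)) λ j → toℕ j ≡ suc (toℕ i) ×
    ((pvert P i ≡ u × pvert P j ≡ v) ⊎ (pvert P i ≡ v × pvert P j ≡ u))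

  IntersectionIs : Cycle G → Cycle G → ∀ {t} → Path G t → Set
  IntersectionIs C C' P =
    (∀ u → (OnCycle C u × OnCycle C' u → OnPath P u) × (OnPath P u → OnCycle C u × OnCycle C' u)) ×
    (∀ u v → (CycleEdge C u v × CycleEdge C' u v → PathEdge P u v) ×
             (PathEdge P u v → CycleEdge C u v × CycleEdge C' u v))

  OfType : ℕ → Cycle G → Set
  OfType i C = len C % 4 ≡ i

InE12 : ∀ {n} → Graph n → Set
InE12 G = Euler G
        × (∀ (C : Cycle G) → OfType 1 C ⊎ OfType 2 C)
        × (∃ λ (C : Cycle G) → OfType 1 C)
        × (∃ λ (C : Cycle G) → OfType 2 C)

-- Write |C| = t + a and |C'| = t + b. The arcs of C and C' outside P are paths with the
-- same ends as P and no inner vertex in common, so they close up into a cycle of length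
-- a + b; it has at least three vertices because for a = b = 1 the edge joining the ends
-- of P would lie in both cycles and hence in P. In ε₁₂ this forces a + b ≡ 1 or 2 (mod 4),
-- and since |C| + |C'| = 2t + (a + b), the types of C and C' then determine t mod 2.

module Submission where

open import Defs hiding (sym)
open import Function using (_∘_)
open import Data.Nat
open import Data.Nat.Properties
open import Data.Nat.DivMod
open import Data.Nat.Tactic.RingSolver using (solve-∀)
open import Data.Fin using (Fin; toℕ)
open import Data.Fin.Properties using (toℕ-fromℕ<; toℕ-injective; toℕ<n)
open import Data.Product using (∃-syntax; _×_; _,_; proj₁; proj₂)
open import Data.Sum using (_⊎_; inj₁; inj₂; swap)
open import Data.Empty using (⊥; ⊥-elim)
open import Data.Nat.Divisibility using (divides)
open import Relation.Nullary using (Dec)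
open import Relation.Nullary.Decidable using (toWitness; _→-dec_; _⊎-dec_; _×-dec_)
open import Relation.Binary.PropositionalEquality
open ≡-Reasoning

AllowedType : ℕ → Set
AllowedType r = r ≡ 1 ⊎ r ≡ 2

ForcesParity : ℕ → ℕ → ℕ → Set
ForcesParity x y p =
  (((x ≡ 2 × y ≡ 2) ⊎ (x ≡ 1 × y ≡ 2) ⊎ (x ≡ 2 × y ≡ 1)) → p ≡ 1) × ((x ≡ 1 × y ≡ 1) → p ≡ 0)

ArcParity : ℕ → ℕ → ℕ → Set
ArcParity t a b = AllowedType ((a + b) % 4) → ForcesParity ((t + a) % 4) ((t + b) % 4) (t % 2)

arcParity? : ∀ t a b → Dec (ArcParity t a b)
arcParity? t a b = allowed? ((a + b) % 4) →-dec forces? ((t + a) % 4) ((t + b) % 4) (t % 2)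
  where
  allowed? : ∀ r → Dec (AllowedType r)
  allowed? r = r ≟ 1 ⊎-dec r ≟ 2
  forces? : ∀ x y p → Dec (ForcesParity x y p)
  forces? x y p =
    ((((x ≟ 2) ×-dec (y ≟ 2)) ⊎-dec ((x ≟ 1) ×-dec (y ≟ 2)) ⊎-dec ((x ≟ 2) ×-dec (y ≟ 1)))
      →-dec (p ≟ 1))
    ×-dec (((x ≟ 1) ×-dec (y ≟ 1)) →-dec (p ≟ 0))

arcParity-residues : ∀ {t} → t < 4 → ∀ {a} → a < 4 → ∀ {b} → b < 4 → ArcParity t a b
arcParity-residues = toWitness {a? = allUpTo? (λ t → allUpTo? (λ a → allUpTo? (arcParity? t a) 4) 4) 4} _

arcParity : ∀ t a b → ArcParity t a b
arcParity t a b
  rewrite %-distribˡ-+ a b 4 ⦃ _ ⦄ | %-distribˡ-+ t a 4 ⦃ _ ⦄ | %-distribˡ-+ t b 4 ⦃ _ ⦄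
        | sym (m∣n⇒o%n%m≡o%m 2 4 t ⦃ _ ⦄ ⦃ _ ⦄ (divides 2 refl))
  = arcParity-residues (m%n<n t 4) (m%n<n a 4) (m%n<n b 4)

private
  a+c*L≡c+a+c*[L∸1] : ∀ L .{{_ : NonZero L}} a c → a + c * L ≡ c + a + c * (L ∸ 1)
  a+c*L≡c+a+c*[L∸1] (suc ℓ) a c = identity ℓ a c
    where
    identity : ∀ ℓ a c → a + c * suc ℓ ≡ c + a + c * ℓ
    identity = solve-∀

  [L∸1]²%L≡1%L : ∀ L .{{_ : NonZero L}} → (L ∸ 1) * (L ∸ 1) % L ≡ 1 % L
  [L∸1]²%L≡1%L 1              = refl
  [L∸1]²%L≡1%L (suc (suc ℓ)) =
    trans (cong (_% suc (suc ℓ)) (square ℓ)) ([m+kn]%n≡m%n 1 ℓ (suc (suc ℓ)))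
    where
    square : ∀ ℓ → suc ℓ * suc ℓ ≡ 1 + ℓ * suc (suc ℓ)
    square = solve-∀

module Modulo (L : ℕ) {{_ : NonZero L}} where

  infix 4 _≡ₘ_
  _≡ₘ_ : ℕ → ℕ → Set
  a ≡ₘ b = a % L ≡ b % L

  +-congʳ : ∀ {a b} c → a ≡ₘ b → a + c ≡ₘ b + c
  +-congʳ {a} {b} c a≡b = begin
    (a + c) % L          ≡⟨ %-distribˡ-+ a c L ⟩
    (a % L + c % L) % L  ≡⟨ cong (λ x → (x + c % L) % L) a≡b ⟩
    (b % L + c % L) % L  ≡⟨ %-distribˡ-+ b c L ⟨
    (b + c) % L          ∎

  +-congˡ : ∀ c {a b} → a ≡ₘ b → c + a ≡ₘ c + b
  +-congˡ c {a} {b} a≡b = begin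
    (c + a) % L  ≡⟨ cong (_% L) (+-comm c a) ⟩
    (a + c) % L  ≡⟨ +-congʳ c a≡b ⟩
    (b + c) % L  ≡⟨ cong (_% L) (+-comm b c) ⟩
    (c + b) % L  ∎

  +-cancelˡ : ∀ c {a b} → c + a ≡ₘ c + b → a ≡ₘ b
  +-cancelˡ c {a} {b} c+a≡c+b = begin
    a % L                      ≡⟨ [m+kn]%n≡m%n a c L ⟨
    (a + c * L) % L            ≡⟨ cong (_% L) (a+c*L≡c+a+c*[L∸1] L a c) ⟩
    (c + a + c * (L ∸ 1)) % L  ≡⟨ +-congʳ (c * (L ∸ 1)) c+a≡c+b ⟩
    (c + b + c * (L ∸ 1)) % L  ≡⟨ cong (_% L) (a+c*L≡c+a+c*[L∸1] L b c) ⟨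
    (b + c * L) % L            ≡⟨ [m+kn]%n≡m%n b c L ⟩
    b % L                      ∎

  *-congʳ : ∀ {a b} c → a ≡ₘ b → a * c ≡ₘ b * c
  *-congʳ {a} {b} c a≡b = begin
    (a * c) % L            ≡⟨ %-distribˡ-* a c L ⟩
    (a % L * (c % L)) % L  ≡⟨ cong (λ x → (x * (c % L)) % L) a≡b ⟩
    (b % L * (c % L)) % L  ≡⟨ %-distribˡ-* b c L ⟨
    (b * c) % L            ∎

  *-congˡ : ∀ c {a b} → a ≡ₘ b → c * a ≡ₘ c * b
  *-congˡ c {a} {b} a≡b = begin
    (c * a) % L  ≡⟨ cong (_% L) (*-comm c a) ⟩
    (a * c) % L  ≡⟨ *-congʳ c a≡b ⟩
    (b * c) % L  ≡⟨ cong (_% L) (*-comm b c) ⟩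
    (c * b) % L  ∎

  L≡ₘ0 : L ≡ₘ 0
  L≡ₘ0 = trans (n%n≡0 L) (sym (m*n%n≡0 0 L))

  pred-≡ₘ : ∀ k → suc k + (L ∸ 1) ≡ₘ k
  pred-≡ₘ k = trans (cong (_% L) (trans (sym (+-suc k (L ∸ 1))) (cong (k +_) (suc-pred L))))
                    ([m+n]%n≡m%n k L)

  [L∸1]²≡ₘ1 : (L ∸ 1) * (L ∸ 1) ≡ₘ 1
  [L∸1]²≡ₘ1 = [L∸1]²%L≡1%L L

  *[L∸1]²≡ₘ : ∀ x → x * (L ∸ 1) * (L ∸ 1) ≡ₘ x
  *[L∸1]²≡ₘ x = begin
    x * (L ∸ 1) * (L ∸ 1) % L    ≡⟨ cong (_% L) (*-assoc x (L ∸ 1) (L ∸ 1)) ⟩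
    x * ((L ∸ 1) * (L ∸ 1)) % L  ≡⟨ *-congˡ x [L∸1]²≡ₘ1 ⟩
    x * 1 % L                    ≡⟨ cong (_% L) (*-identityʳ x) ⟩
    x % L                        ∎

  ≡ₘ⇒≡ : ∀ {a b} → a < L → b < L → a ≡ₘ b → a ≡ b
  ≡ₘ⇒≡ {a} {b} a<L b<L a≡b = trans (sym (m<n⇒m%n≡m a<L)) (trans a≡b (m<n⇒m%n≡m b<L))

  toℕ-mod-≡ₘ : ∀ k → toℕ (k mod L) ≡ₘ k
  toℕ-mod-≡ₘ k = trans (cong (_% L) (toℕ-fromℕ< (m%n<n k L))) (m%n%n≡m%n k L)

  ≡ₘ⇒mod≡ : ∀ {a b} → a ≡ₘ b → a mod L ≡ b mod L
  ≡ₘ⇒mod≡ {a} {b} a≡b = toℕ-injective (begin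
    toℕ (a mod L)  ≡⟨ toℕ-fromℕ< (m%n<n a L) ⟩
    a % L          ≡⟨ a≡b ⟩
    b % L          ≡⟨ toℕ-fromℕ< (m%n<n b L) ⟨
    toℕ (b mod L)  ∎)

  toℕ-mod : (i : Fin L) → toℕ i mod L ≡ i
  toℕ-mod i = toℕ-injective (trans (toℕ-fromℕ< (m%n<n (toℕ i) L)) (m<n⇒m%n≡m (toℕ<n i)))

  CycNext⇒≡ₘ : ∀ {i j} → CycNext L i j → toℕ j ≡ₘ suc (toℕ i)
  CycNext⇒≡ₘ (inj₁ j≡1+i)           = cong (_% L) j≡1+i
  CycNext⇒≡ₘ (inj₂ (1+i≡L , j≡0)) = trans (cong (_% L) j≡0) (sym (trans (cong (_% L) 1+i≡L) L≡ₘ0))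

  ≡ₘ⇒CycNext : ∀ {i j} → toℕ j ≡ₘ suc (toℕ i) → CycNext L i j
  ≡ₘ⇒CycNext {i} {j} j≡1+i with m≤n⇒m<n∨m≡n (toℕ<n i)
  ... | inj₁ 1+i<L = inj₁ (≡ₘ⇒≡ (toℕ<n j) 1+i<L j≡1+i)
  ... | inj₂ 1+i≡L =
    inj₂ (1+i≡L , ≡ₘ⇒≡ (toℕ<n j) (>-nonZero⁻¹ L) (trans j≡1+i (trans (cong (_% L) 1+i≡L) L≡ₘ0)))

splice : {A : Set} → ℕ → (ℕ → A) → (ℕ → A) → ℕ → A
splice zero    f g i       = g i
splice (suc a) f g zero    = f zero
splice (suc a) f g (suc i) = splice a (f ∘ suc) g i

module _ {A : Set} where

  splice-≤ : ∀ a (f g : ℕ → A) → f a ≡ g 0 → ∀ {i} → i ≤ a → splice a f g i ≡ f i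
  splice-≤ zero    f g fa≡g0 {zero}  _          = sym fa≡g0
  splice-≤ (suc a) f g fa≡g0 {zero}  _          = refl
  splice-≤ (suc a) f g fa≡g0 {suc i} (s≤s i≤a) = splice-≤ a (f ∘ suc) g fa≡g0 i≤a

  splice-+ : ∀ a (f g : ℕ → A) j → splice a f g (a + j) ≡ g j
  splice-+ zero    f g j = refl
  splice-+ (suc a) f g j = splice-+ a (f ∘ suc) g j

data Split (a : ℕ) : ℕ → Set where
  left  : ∀ {i} → i < a → Split a i
  right : ∀ j → Split a (a + j)

split : ∀ a i → Split a i
split zero    i       = right i
split (suc a) zero    = left z<s
split (suc a) (suc i) with split a i
... | left i<a = left (s≤s i<a)
... | right j  = right j

three≤+ : ∀ {a b} → 0 < a → 0 < b → (a ≡ 1 → b ≡ 1 → ⊥) → 3 ≤ a + b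
three≤+ {1}           {1}           _ _ not11 = ⊥-elim (not11 refl refl)
three≤+ {1}           {suc (suc b)} _ _ _     = s≤s (s≤s (s≤s z≤n))
three≤+ {suc (suc a)} {suc b}       _ _ _     = s≤s (s≤s (≤-trans (s≤s z≤n) (m≤n+m (suc b) a)))

module _ {n : ℕ} {G : Graph n} where

  Adj-sym : ∀ {u v} → Adj G u v → Adj G v u
  Adj-sym {u} {v} = trans (Graph.sym G v u)

  CycleEdge-sym : ∀ {C : Cycle G} {u v} → CycleEdge C u v → CycleEdge C v u
  CycleEdge-sym (i , j , next , inj₁ ends) = i , j , next , inj₂ ends
  CycleEdge-sym (i , j , next , inj₂ ends) = i , j , next , inj₁ ends

  PathEdge-sym : ∀ {t} {P : Path G t} {u v} → PathEdge P u v → PathEdge P v u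
  PathEdge-sym (i , j , next , inj₁ ends) = i , j , next , inj₂ ends
  PathEdge-sym (i , j , next , inj₂ ends) = i , j , next , inj₁ ends

  CycleEdge⇒Adj : ∀ {C : Cycle G} {u v} → CycleEdge C u v → Adj G u v
  CycleEdge⇒Adj {C} (i , j , next , inj₁ (i↦u , j↦v)) = subst₂ (Adj G) i↦u j↦v (edges C i j next)
  CycleEdge⇒Adj {C} (i , j , next , inj₂ (i↦v , j↦u)) = Adj-sym (subst₂ (Adj G) i↦v j↦u (edges C i j next))

  CycleEdge⇒OnCycle : ∀ {C : Cycle G} {u v} → CycleEdge C u v → OnCycle C u
  CycleEdge⇒OnCycle (i , j , _ , inj₁ (i↦u , _)) = i , i↦u
  CycleEdge⇒OnCycle (i , j , _ , inj₂ (_ , j↦u)) = j , j↦u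

  closedWalk⇒Cycle : (m : ℕ) → 3 ≤ m → (f : ℕ → Fin n) →
    (∀ {i j} → i < m → j < m → f i ≡ f j → i ≡ j) →
    (∀ i → suc i < m → Adj G (f i) (f (suc i))) →
    (∀ i → suc i ≡ m → Adj G (f i) (f 0)) →
    Cycle G
  closedWalk⇒Cycle m 3≤m f injective adjacent closing = record
    { len      = m
    ; len≥3    = 3≤m
    ; vert     = f ∘ toℕ
    ; vert-inj = λ e → toℕ-injective (injective (toℕ<n _) (toℕ<n _) e)
    ; edges    = edge
    }
    where
    edge : ∀ i j → CycNext m i j → Adj G (f (toℕ i)) (f (toℕ j))
    edge i j (inj₁ j≡1+i) =
      subst (Adj G (f (toℕ i)) ∘ f) (sym j≡1+i) (adjacent (toℕ i) (subst (_< m) j≡1+i (toℕ<n j)))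
    edge i j (inj₂ (1+i≡m , j≡0)) = subst (Adj G (f (toℕ i)) ∘ f) (sym j≡0) (closing (toℕ i) 1+i≡m)

  module CyclicWalks (C : Cycle G) where

    L : ℕ
    L = len C

    0<L : 0 < L
    0<L = ≤-trans (s≤s z≤n) (len≥3 C)

    instance
      L-nonZero : NonZero L
      L-nonZero = >-nonZero 0<L

    open Modulo L public

    record IsCyclicWalk (W : ℕ → Fin n) : Set where
      field
        cong-≡ₘ    : ∀ {a b} → a ≡ₘ b → W a ≡ W b
        injective  : ∀ {a b} → W a ≡ W b → a ≡ₘ b
        edge       : ∀ k → CycleEdge C (W k) (W (suc k))
        -- k + (L ∸ 1) is the index preceding k modulo L
        neighbours : ∀ k v → CycleEdge C (W k) v → v ≡ W (suc k) ⊎ v ≡ W (k + (L ∸ 1))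

      injective-< : ∀ {a b} → a < L → b < L → W a ≡ W b → a ≡ b
      injective-< a<L b<L = ≡ₘ⇒≡ a<L b<L ∘ injective

      closes : W L ≡ W 0
      closes = cong-≡ₘ L≡ₘ0

    open IsCyclicWalk

    vertAt : ℕ → Fin n
    vertAt k = vert C (k mod L)

    vert≡vertAt : ∀ i → vert C i ≡ vertAt (toℕ i)
    vert≡vertAt i = cong (vert C) (sym (toℕ-mod i))

    index-≡ₘ : ∀ {i k} → vert C i ≡ vertAt k → toℕ i ≡ₘ k
    index-≡ₘ {i} {k} i↦k = trans (cong (λ j → toℕ j % L) (vert-inj C i↦k)) (toℕ-mod-≡ₘ k)

    vertAt-surjective : ∀ {u} → OnCycle C u → ∃[ k ] vertAt k ≡ u
    vertAt-surjective (i , i↦u) = toℕ i , trans (sym (vert≡vertAt i)) i↦u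

    vertAt-isCyclicWalk : IsCyclicWalk vertAt
    vertAt-isCyclicWalk = record
      { cong-≡ₘ    = cong (vert C) ∘ ≡ₘ⇒mod≡
      ; injective  = λ {a} e → trans (sym (toℕ-mod-≡ₘ a)) (index-≡ₘ e)
      ; edge       = λ k → k mod L , suc k mod L , ≡ₘ⇒CycNext (next k) , inj₁ (refl , refl)
      ; neighbours = neighbours′
      }
      where
      next : ∀ k → toℕ (suc k mod L) ≡ₘ suc (toℕ (k mod L))
      next k = trans (toℕ-mod-≡ₘ (suc k)) (sym (+-congˡ 1 (toℕ-mod-≡ₘ k)))

      neighbours′ : ∀ k v → CycleEdge C (vertAt k) v → v ≡ vertAt (suc k) ⊎ v ≡ vertAt (k + (L ∸ 1))
      neighbours′ k v (i , j , i→j , inj₁ (i↦k , j↦v)) = inj₁ (begin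
        v                 ≡⟨ sym j↦v ⟩
        vert C j          ≡⟨ vert≡vertAt j ⟩
        vertAt (toℕ j)    ≡⟨ cong (vert C) (≡ₘ⇒mod≡ j≡k+1) ⟩
        vertAt (suc k)    ∎)
        where
        j≡k+1 : toℕ j ≡ₘ suc k
        j≡k+1 = trans (CycNext⇒≡ₘ i→j) (+-congˡ 1 (index-≡ₘ i↦k))
      neighbours′ k v (i , j , i→j , inj₂ (i↦v , j↦k)) = inj₂ (begin
        v                     ≡⟨ sym i↦v ⟩
        vert C i              ≡⟨ vert≡vertAt i ⟩
        vertAt (toℕ i)        ≡⟨ cong (vert C) (≡ₘ⇒mod≡ i≡k-1) ⟩
        vertAt (k + (L ∸ 1))  ∎)
        where
        i≡k-1 : toℕ i ≡ₘ k + (L ∸ 1)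
        i≡k-1 = trans (sym (pred-≡ₘ (toℕ i)))
                      (+-congʳ (L ∸ 1) (trans (sym (CycNext⇒≡ₘ i→j)) (index-≡ₘ j↦k)))

    shift : ∀ {W} → IsCyclicWalk W → ∀ s → IsCyclicWalk (λ k → W (s + k))
    shift {W} w s = record
      { cong-≡ₘ    = cong-≡ₘ w ∘ +-congˡ s
      ; injective  = +-cancelˡ s ∘ injective w
      ; edge       = λ k → subst (CycleEdge C (W (s + k)) ∘ W) (sym (+-suc s k)) (edge w (s + k))
      ; neighbours = neighbours′
      }
      where
      neighbours′ : ∀ k v → CycleEdge C (W (s + k)) v → v ≡ W (s + suc k) ⊎ v ≡ W (s + (k + (L ∸ 1)))
      neighbours′ k v e with neighbours w (s + k) v e
      ... | inj₁ v≡next = inj₁ (trans v≡next (cong W (sym (+-suc s k))))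
      ... | inj₂ v≡prev = inj₂ (trans v≡prev (cong W (+-assoc s k (L ∸ 1))))

    -- L ∸ 1 ≡ -1 modulo L, so this runs through C in the opposite direction.
    reflect : ∀ {W} → IsCyclicWalk W → IsCyclicWalk (λ k → W (k * (L ∸ 1)))
    reflect {W} w = record
      { cong-≡ₘ    = cong-≡ₘ w ∘ *-congʳ (L ∸ 1)
      ; injective  = λ {a} {b} e →
          trans (sym (*[L∸1]²≡ₘ a)) (trans (*-congʳ (L ∸ 1) (injective w e)) (*[L∸1]²≡ₘ b))
      ; edge       = edge′
      ; neighbours = neighbours′
      }
      where
      edge′ : ∀ k → CycleEdge C (W (k * (L ∸ 1))) (W (suc k * (L ∸ 1)))
      edge′ k = CycleEdge-sym {C = C}
        (subst (CycleEdge C (W (suc k * (L ∸ 1)))) (cong-≡ₘ w wraps) (edge w (suc k * (L ∸ 1))))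
        where
        wraps : suc (L ∸ 1 + k * (L ∸ 1)) ≡ₘ k * (L ∸ 1)
        wraps = trans (cong (λ x → suc x % L) (+-comm (L ∸ 1) (k * (L ∸ 1)))) (pred-≡ₘ (k * (L ∸ 1)))

      neighbours′ : ∀ k v → CycleEdge C (W (k * (L ∸ 1))) v →
                    v ≡ W (suc k * (L ∸ 1)) ⊎ v ≡ W ((k + (L ∸ 1)) * (L ∸ 1))
      neighbours′ k v e with neighbours w (k * (L ∸ 1)) v e
      ... | inj₁ v≡next = inj₂ (trans v≡next (cong-≡ₘ w next≡ₘ))
        where
        next≡ₘ : suc (k * (L ∸ 1)) ≡ₘ (k + (L ∸ 1)) * (L ∸ 1)
        next≡ₘ = begin
          suc (k * (L ∸ 1)) % L                   ≡⟨ cong (_% L) (+-comm 1 (k * (L ∸ 1))) ⟩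
          (k * (L ∸ 1) + 1) % L                   ≡⟨ +-congˡ (k * (L ∸ 1)) [L∸1]²≡ₘ1 ⟨
          (k * (L ∸ 1) + (L ∸ 1) * (L ∸ 1)) % L   ≡⟨ cong (_% L) (*-distribʳ-+ (L ∸ 1) k (L ∸ 1)) ⟨
          (k + (L ∸ 1)) * (L ∸ 1) % L             ∎
      ... | inj₂ v≡prev = inj₁ (trans v≡prev (cong W (+-comm (k * (L ∸ 1)) (L ∸ 1))))

  module PathWalks {t : ℕ} (P : Path G t) where

    record IsPathWalk (q : ℕ → Fin n) : Set where
      field
        injective : ∀ {a b} → a ≤ t → b ≤ t → q a ≡ q b → a ≡ b
        edge      : ∀ k → k < t → PathEdge P (q k) (q (suc k))

    open IsPathWalk

    pathAt : ℕ → Fin n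
    pathAt k = pvert P (k mod suc t)

    toℕ-mod-≤ : ∀ {k} → k ≤ t → toℕ (k mod suc t) ≡ k
    toℕ-mod-≤ k≤t = trans (toℕ-fromℕ< _) (m≤n⇒m%n≡m k≤t)

    pvert≡pathAt : ∀ i → pvert P i ≡ pathAt (toℕ i)
    pvert≡pathAt i = cong (pvert P) (toℕ-injective (sym (toℕ-mod-≤ (s≤s⁻¹ (toℕ<n i)))))

    pathAt-isPathWalk : IsPathWalk pathAt
    pathAt-isPathWalk = record
      { injective = λ a≤t b≤t e →
          trans (sym (toℕ-mod-≤ a≤t)) (trans (cong toℕ (pvert-inj P e)) (toℕ-mod-≤ b≤t))
      ; edge      = λ k k<t → k mod suc t , suc k mod suc t ,
                              trans (toℕ-mod-≤ k<t) (cong suc (sym (toℕ-mod-≤ (<⇒≤ k<t)))) , inj₁ (refl , refl)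
      }

    pathAt-surjective : ∀ {u} → OnPath P u → ∃[ k ] k ≤ t × pathAt k ≡ u
    pathAt-surjective (i , i↦u) = toℕ i , s≤s⁻¹ (toℕ<n i) , trans (sym (pvert≡pathAt i)) i↦u

    pathEdge-consecutive : ∀ {i j} → i ≤ t → j ≤ t → PathEdge P (pathAt i) (pathAt j) →
                           suc i ≡ j ⊎ suc j ≡ i
    pathEdge-consecutive i≤t j≤t (x , y , y≡1+x , inj₁ (x↦i , y↦j)) =
      inj₁ (trans (cong suc (sym (index x i≤t x↦i))) (trans (sym y≡1+x) (index y j≤t y↦j)))
      where
      index : ∀ x {k} → k ≤ t → pvert P x ≡ pathAt k → toℕ x ≡ k
      index x k≤t x↦k =
        injective pathAt-isPathWalk (s≤s⁻¹ (toℕ<n x)) k≤t (trans (sym (pvert≡pathAt x)) x↦k)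
    pathEdge-consecutive i≤t j≤t (x , y , y≡1+x , inj₂ (x↦j , y↦i)) =
      swap (pathEdge-consecutive j≤t i≤t (x , y , y≡1+x , inj₁ (x↦j , y↦i)))

    reverse : ∀ {q} → IsPathWalk q → IsPathWalk (λ k → q (t ∸ k))
    reverse {q} p = record
      { injective = λ {a} {b} a≤t b≤t e → ∸-cancelˡ-≡ a≤t b≤t (injective p (m∸n≤m t a) (m∸n≤m t b) e)
      ; edge      = λ k k<t → PathEdge-sym {P = P} (subst (PathEdge P (q (t ∸ suc k)) ∘ q)
          (sym (+-∸-assoc 1 k<t)) (edge p (t ∸ suc k) (∸-monoʳ-< z<s k<t)))
      }

  module Alignment (C : Cycle G) {t : ℕ} (P : Path G t)
                   (P⊆C : ∀ {u v} → PathEdge P u v → CycleEdge C u v) where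
    open CyclicWalks C
    open IsCyclicWalk
    open PathWalks P
    open IsPathWalk

    record AlignedWalk (q : ℕ → Fin n) : Set where
      field
        walk         : ℕ → Fin n
        isCyclicWalk : IsCyclicWalk walk
        agrees       : ∀ k → k ≤ t → walk k ≡ q k

    module _ {q} (p : IsPathWalk q) where

      next-agrees : ∀ {W} → IsCyclicWalk W → ∀ k → suc (suc k) ≤ t →
                    W k ≡ q k → W (suc k) ≡ q (suc k) → W (suc (suc k)) ≡ q (suc (suc k))
      next-agrees {W} w k k+2≤t Wk≡qk Wk+1≡qk+1
        with neighbours w (suc k) (q (suc (suc k)))
               (subst (λ x → CycleEdge C x _) (sym Wk+1≡qk+1) (P⊆C (edge p (suc k) k+2≤t)))
      ... | inj₁ next = sym next
      ... | inj₂ prev = ⊥-elim (<⇒≢ (m<n⇒m<1+n (n<1+n k))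
                          (sym (injective p k+2≤t (≤-trans (n≤1+n k) (<⇒≤ k+2≤t)) qk+2≡qk)))
        where
        qk+2≡qk : q (suc (suc k)) ≡ q k
        qk+2≡qk = trans prev (trans (cong-≡ₘ w (pred-≡ₘ k)) Wk≡qk)

      extend : ∀ {W} → IsCyclicWalk W → W 0 ≡ q 0 → W 1 ≡ q 1 → ∀ k → k ≤ t → W k ≡ q k
      extend w W0≡q0 W1≡q1 zero          _      = W0≡q0
      extend w W0≡q0 W1≡q1 (suc zero)    _      = W1≡q1
      extend w W0≡q0 W1≡q1 (suc (suc k)) k+2≤t = next-agrees w k k+2≤t
        (extend w W0≡q0 W1≡q1 k (≤-trans (n≤1+n k) (<⇒≤ k+2≤t)))
        (extend w W0≡q0 W1≡q1 (suc k) (<⇒≤ k+2≤t))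

      orient : 0 < t → ∀ {W} → IsCyclicWalk W → W 0 ≡ q 0 → AlignedWalk q
      orient 0<t {W} w W0≡q0
        with neighbours w 0 (q 1) (subst (λ x → CycleEdge C x (q 1)) (sym W0≡q0) (P⊆C (edge p 0 0<t)))
      ... | inj₁ next = record { walk = W ; isCyclicWalk = w ; agrees = extend w W0≡q0 (sym next) }
      ... | inj₂ prev = record
        { walk         = λ k → W (k * (L ∸ 1))
        ; isCyclicWalk = reflect w
        ; agrees       = extend (reflect w) W0≡q0 (trans (cong W (+-identityʳ (L ∸ 1))) (sym prev))
        }

      alignedWalk : 0 < t → AlignedWalk q
      alignedWalk 0<t with vertAt-surjective (CycleEdge⇒OnCycle {C = C} (P⊆C (edge p 0 0<t)))
      ... | s , s↦q0 = orient 0<t (shift vertAt-isCyclicWalk s) (trans (cong vertAt (+-identityʳ s)) s↦q0)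

      path-shorter : AlignedWalk q → t < L
      path-shorter A = ≰⇒> λ L≤t → <⇒≢ 0<L (sym (injective p L≤t z≤n
        (trans (sym (agrees L L≤t)) (trans (closes isCyclicWalk) (agrees 0 z≤n)))))
        where open AlignedWalk A

  module Gluing (C C' : Cycle G) {t : ℕ} (P : Path G t) (0<t : 0 < t) (I : IntersectionIs C C' P) where
    open PathWalks P

    common-vertex : ∀ {u} → OnCycle C u → OnCycle C' u → OnPath P u
    common-vertex onC onC' = proj₁ (proj₁ I _) (onC , onC')

    common-edge : ∀ {u v} → CycleEdge C u v → CycleEdge C' u v → PathEdge P u v
    common-edge inC inC' = proj₁ (proj₂ I _ _) (inC , inC')

    module A  = Alignment C  P (λ e → proj₁ (proj₂ (proj₂ I _ _) e))
    module A' = Alignment C' P (λ e → proj₂ (proj₂ (proj₂ I _ _) e))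

    opaque
      forward : A.AlignedWalk pathAt
      forward = A.alignedWalk pathAt-isPathWalk 0<t

      backward : A'.AlignedWalk (λ k → pathAt (t ∸ k))
      backward = A'.alignedWalk (reverse pathAt-isPathWalk) 0<t

    open A.AlignedWalk forward renaming (walk to W; isCyclicWalk to W-isCyclicWalk; agrees to W-agrees)
    open A'.AlignedWalk backward renaming (walk to U; isCyclicWalk to U-isCyclicWalk; agrees to U-agrees)
    module W = CyclicWalks.IsCyclicWalk W-isCyclicWalk
    module U = CyclicWalks.IsCyclicWalk U-isCyclicWalk

    t<L : t < len C
    t<L = A.path-shorter pathAt-isPathWalk forward

    t<L' : t < len C'
    t<L' = A'.path-shorter (reverse pathAt-isPathWalk) backward

    a b : ℕ
    a = len C ∸ t
    b = len C' ∸ t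

    t+a≡L : t + a ≡ len C
    t+a≡L = m+[n∸m]≡n (<⇒≤ t<L)

    t+b≡L' : t + b ≡ len C'
    t+b≡L' = m+[n∸m]≡n (<⇒≤ t<L')

    W-<-len : ∀ {i} → i < a → t + i < len C
    W-<-len i<a = subst (t + _ <_) t+a≡L (+-monoʳ-< t i<a)

    U-<-len : ∀ {j} → j < b → t + j < len C'
    U-<-len j<b = subst (t + _ <_) t+b≡L' (+-monoʳ-< t j<b)

    U-start : U t ≡ pathAt 0
    U-start = trans (U-agrees t ≤-refl) (cong pathAt (n∸n≡0 t))

    W-closes : W (t + a) ≡ pathAt 0
    W-closes = trans (cong W t+a≡L) (trans W.closes (W-agrees 0 z≤n))

    U-closes : U (t + b) ≡ pathAt t
    U-closes = trans (cong U t+b≡L') (trans U.closes (U-agrees 0 z≤n))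

    -- For i < a, W (t + i) runs along C outside P from p_t towards p_0; for j < b,
    -- U (t + j) runs along C' outside P from p_0 towards p_t.
    arcs : ℕ → Fin n
    arcs = splice a (λ i → W (t + i)) (λ j → U (t + j))

    arcs-W : ∀ {i} → i ≤ a → arcs i ≡ W (t + i)
    arcs-W = splice-≤ a _ _ (trans W-closes (trans (sym U-start) (cong U (sym (+-identityʳ t)))))

    arcs-U : ∀ j → arcs (a + j) ≡ U (t + j)
    arcs-U = splice-+ a _ _

    arcs-disjoint : ∀ {i j} → i < a → j < b → W (t + i) ≢ U (t + j)
    arcs-disjoint {i} {j} i<a j<b Wt+i≡Ut+j = <⇒≢ 0<t (sym (m+n≡0⇒m≡0 t t+j≡0))
      where
      shared : ∃[ k ] k ≤ t × pathAt k ≡ W (t + i)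
      shared = pathAt-surjective (common-vertex
        (CycleEdge⇒OnCycle {C = C} (W.edge (t + i)))
        (subst (OnCycle C') (sym Wt+i≡Ut+j) (CycleEdge⇒OnCycle {C = C'} (U.edge (t + j)))))

      k : ℕ
      k = proj₁ shared

      k≡t : k ≡ t
      k≡t = ≤-antisym (proj₁ (proj₂ shared)) (subst (t ≤_) (sym k≡t+i) (m≤m+n t i))
        where
        k≡t+i : k ≡ t + i
        k≡t+i = W.injective-< (≤-<-trans (proj₁ (proj₂ shared)) t<L) (W-<-len i<a)
                  (trans (W-agrees k (proj₁ (proj₂ shared))) (proj₂ (proj₂ shared)))

      t+j≡0 : t + j ≡ 0
      t+j≡0 = U.injective-< (U-<-len j<b) (≤-<-trans z≤n t<L') (begin
        U (t + j)   ≡⟨ Wt+i≡Ut+j ⟨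
        W (t + i)   ≡⟨ proj₂ (proj₂ shared) ⟨
        pathAt k    ≡⟨ cong pathAt k≡t ⟩
        pathAt t    ≡⟨ U-agrees 0 z≤n ⟨
        U 0         ∎)

    arcs-injective : ∀ {i j} → i < a + b → j < a + b → arcs i ≡ arcs j → i ≡ j
    arcs-injective {i} {j} i<a+b j<a+b e with split a i | split a j
    ... | left i<a | left j<a = +-cancelˡ-≡ t i j (W.injective-< (W-<-len i<a) (W-<-len j<a)
            (trans (sym (arcs-W (<⇒≤ i<a))) (trans e (arcs-W (<⇒≤ j<a)))))
    ... | left i<a | right j′ = ⊥-elim (arcs-disjoint i<a (+-cancelˡ-< a j′ b j<a+b)
            (trans (sym (arcs-W (<⇒≤ i<a))) (trans e (arcs-U j′))))
    ... | right i′ | left j<a = ⊥-elim (arcs-disjoint j<a (+-cancelˡ-< a i′ b i<a+b)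
            (trans (sym (arcs-W (<⇒≤ j<a))) (trans (sym e) (arcs-U i′))))
    ... | right i′ | right j′ = cong (a +_) (+-cancelˡ-≡ t i′ j′ (U.injective-<
            (U-<-len (+-cancelˡ-< a i′ b i<a+b)) (U-<-len (+-cancelˡ-< a j′ b j<a+b))
            (trans (sym (arcs-U i′)) (trans e (arcs-U j′)))))

    arcs-adjacent : ∀ i → suc i < a + b → Adj G (arcs i) (arcs (suc i))
    arcs-adjacent i _ with split a i
    ... | left i<a = subst₂ (Adj G)
            (sym (arcs-W (<⇒≤ i<a))) (sym (trans (arcs-W i<a) (cong W (+-suc t i))))
            (CycleEdge⇒Adj {C = C} (W.edge (t + i)))
    ... | right j = subst₂ (Adj G)
            (sym (arcs-U j))
            (sym (trans (cong arcs (sym (+-suc a j))) (trans (arcs-U (suc j)) (cong U (+-suc t j)))))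
            (CycleEdge⇒Adj {C = C'} (U.edge (t + j)))

    arcs-closing : ∀ i → suc i ≡ a + b → Adj G (arcs i) (arcs 0)
    arcs-closing i 1+i≡a+b with split a i
    ... | left i<a = ⊥-elim (<-irrefl 1+i≡a+b (≤-<-trans i<a (m<m+n a (m<n⇒0<n∸m t<L'))))
    ... | right j = subst₂ (Adj G) (sym (arcs-U j)) (sym arcs0≡) (CycleEdge⇒Adj {C = C'} (U.edge (t + j)))
      where
      b≡1+j : b ≡ suc j
      b≡1+j = +-cancelˡ-≡ a b (suc j) (trans (sym 1+i≡a+b) (sym (+-suc a j)))

      arcs0≡ : arcs 0 ≡ U (suc (t + j))
      arcs0≡ = begin
        arcs 0            ≡⟨ arcs-W z≤n ⟩
        W (t + 0)         ≡⟨ cong W (+-identityʳ t) ⟩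
        W t               ≡⟨ W-agrees t ≤-refl ⟩
        pathAt t          ≡⟨ U-closes ⟨
        U (t + b)         ≡⟨ cong U (trans (cong (t +_) b≡1+j) (+-suc t j)) ⟩
        U (suc (t + j))   ∎

    not-both-one : a ≡ 1 → b ≡ 1 → ⊥
    not-both-one a≡1 b≡1
      with pathEdge-consecutive ≤-refl z≤n (common-edge ends-in-C (CycleEdge-sym {C = C'} ends-in-C'))
      where
      ends-in-C : CycleEdge C (pathAt t) (pathAt 0)
      ends-in-C = subst₂ (CycleEdge C) (W-agrees t ≤-refl)
        (trans (cong W (trans (+-comm 1 t) (cong (t +_) (sym a≡1)))) W-closes) (W.edge t)
      ends-in-C' : CycleEdge C' (pathAt 0) (pathAt t)
      ends-in-C' = subst₂ (CycleEdge C') U-start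
        (trans (cong U (trans (+-comm 1 t) (cong (t +_) (sym b≡1)))) U-closes) (U.edge t)
    ... | inj₁ ()
    ... | inj₂ 1≡t = <⇒≱ (len≥3 C) (≤-reflexive (trans (sym t+a≡L) (cong₂ _+_ (sym 1≡t) a≡1)))

    glued : Cycle G
    glued = closedWalk⇒Cycle (a + b) (three≤+ (m<n⇒0<n∸m t<L) (m<n⇒0<n∸m t<L') not-both-one)
              arcs arcs-injective arcs-adjacent arcs-closing

theorem14 : ∀ {n : ℕ} (G : Graph n) → InE12 G →
    (C C' : Cycle G) (t : ℕ) (P : Path G t) → 0 < t → IntersectionIs C C' P →
    (((OfType 2 C × OfType 2 C') ⊎ (OfType 1 C × OfType 2 C') ⊎ (OfType 2 C × OfType 1 C')) → t % 2 ≡ 1)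
    × ((OfType 1 C × OfType 1 C') → t % 2 ≡ 0)
theorem14 G (_ , cycle-types , _) C C' t P 0<t I =
  subst₂ (λ L L' → ForcesParity (L % 4) (L' % 4) (t % 2)) t+a≡L t+b≡L'
    (arcParity t a b (cycle-types glued))
  where open Gluing C C' P 0<t I
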